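{- Let $s,t \geq 1$ be integers and let $\beta_{s,t}$ be the type-$\beta$ comb with $s$ teeth of length $t$. Then exactly one linear extension of $\beta_{s,t}$ avoids the pattern $132$.
   Context: A linear extension of a finite poset $P$ on a set of integers is a listing $v=[v_1,\dots,v_n]$ of all elements of $P$, each exactly once, such that whenever $a \leq_P b$, $a$ appears before $b$. For $w \in S_3$, a sequence $v$ of distinct integers contains $w$ if there are indices $i<j<k$ with $(v_i,v_j,v_k)$ in the same relative order as $(w_1,w_2,w_3)$; otherwise $v$ avoids $w$. The type-$\beta$ comb $\beta_{s,t}$ is the poset on $\{1,\dots,st\}$ whose order is generated by the relations $ct+1 \leq (c+1)t+1$ for $0 \leq c \leq s-2$ (the spine) and $ct+j \leq ct+j+1$ for $0 \leq c \leq s-1$, $1 \leq j \leq t-1$ (the teeth $\{ct+1,\dots,ct+t\}$). -}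

module Defs where

open import Data.Nat using (ℕ; suc; _+_; _*_; _≤_; _<_)
open import Data.Product using (Σ; _×_; ∃-syntax)
open import Data.List using (List; length; lookup; map; upTo)
open import Data.Fin using (Fin) renaming (_<_ to _<ᶠ_; _≤_ to _≤ᶠ_)
open import Data.List.Relation.Binary.Permutation.Propositional using (_↭_)
open import Relation.Binary.PropositionalEquality using (_≡_)
open import Relation.Binary.Construct.Closure.ReflexiveTransitive using (Star)
open import Relation.Nullary using (¬_)

data CombGen (s t : ℕ) : ℕ → ℕ → Set where
  spine : (c : ℕ) → c + 2 ≤ s → CombGen s t (c * t + 1) (suc c * t + 1)
  tooth : (c j : ℕ) → c < s → 1 ≤ j → j + 1 ≤ t →
          CombGen s t (c * t + j) (c * t + j + 1)

CombLeq : ℕ → ℕ → ℕ → ℕ → Set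
CombLeq s t = Star (CombGen s t)

ground : ℕ → List ℕ
ground n = map suc (upTo n)

IsLinearExtension : ℕ → ℕ → List ℕ → Set
IsLinearExtension s t v =
  (v ↭ ground (s * t)) ×
  ((i j : Fin (length v)) → CombLeq s t (lookup v i) (lookup v j) → i ≤ᶠ j)

Contains132 : List ℕ → Set
Contains132 v = ∃[ i ] ∃[ j ] ∃[ k ]
  (i <ᶠ j × j <ᶠ k × lookup v i < lookup v k × lookup v k < lookup v j)

Avoids132 : List ℕ → Set
Avoids132 v = ¬ Contains132 v

-- 1 lies below every element of β_{s,t}, so a linear extension must start with 1.
-- Every later entry exceeds 1, so an occurrence of 21 after the first entry would
-- complete a 132; hence a 132-avoiding linear extension is increasing, and the only
-- increasing arrangement of {1,…,st} is 1,2,…,st, which is indeed a linear extension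
-- because every covering relation of the comb goes from a smaller to a larger integer.
module Submission where

open import Defs
open import Data.Nat using (ℕ; zero; suc; _+_; _*_; _/_; _%_; _≤_; _<_; z≤n; s≤s; s≤s⁻¹; NonZero; >-nonZero⁻¹)
open import Data.Nat.Properties
open import Data.Nat.DivMod using (m≡m%n+[m/n]*n; m%n<n)
open import Data.Fin using (Fin; toℕ; cast) renaming (zero to fzero; suc to fsuc; _<_ to _<ᶠ_; _≤_ to _≤ᶠ_)
open import Data.Fin.Properties using (toℕ-cast)
open import Data.List using (List; []; _∷_; length; lookup; map; upTo)
open import Data.List.Properties using (length-map; lookup-upTo)
open import Data.List.Membership.Propositional using (_∈_)
open import Data.List.Membership.Propositional.Properties using (∈-map⁺; ∈-map⁻; ∈-upTo⁺; ∈-upTo⁻; ∈-lookup)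
open import Data.List.Relation.Unary.Any using (here; there; index)
open import Data.List.Relation.Unary.Any.Properties using (lookup-index)
open import Data.List.Relation.Unary.Linked using ([]; [-]; _∷_)
open import Data.List.Relation.Unary.Sorted.TotalOrder ≤-totalOrder using (Sorted)
open import Data.List.Relation.Unary.Sorted.TotalOrder.Properties using (↗↭↗⇒≋)
open import Data.List.Relation.Binary.Pointwise using (Pointwise-≡⇒≡)
open import Data.List.Relation.Binary.Permutation.Propositional using (_↭_; ↭-refl; ↭-sym; ↭⇒↭ₛ)
open import Data.List.Relation.Binary.Permutation.Propositional.Properties using (∈-resp-↭)
open import Data.Product using (_×_; ∃-syntax; _,_)
open import Relation.Binary.PropositionalEquality using (_≡_; refl; sym; trans; cong; subst; subst₂)
open import Relation.Binary.Construct.Closure.ReflexiveTransitive using (ε; _◅_; _◅◅_)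
open import Relation.Nullary using (¬_)
open import Data.Empty using (⊥-elim)

lookup-map : ∀ {A B : Set} (f : A → B) (xs : List A) (i : Fin (length (map f xs))) →
             lookup (map f xs) i ≡ f (lookup xs (cast (length-map f xs) i))
lookup-map f (x ∷ xs) fzero    = refl
lookup-map f (x ∷ xs) (fsuc i) = lookup-map f xs i

lookup-ground : ∀ n (i : Fin (length (ground n))) → lookup (ground n) i ≡ suc (toℕ i)
lookup-ground n i =
  trans (lookup-map suc (upTo n) i)
        (cong suc (trans (lookup-upTo n _) (toℕ-cast (length-map suc (upTo n)) i)))

∈-ground⇒positive : ∀ {n x} → x ∈ ground n → 1 ≤ x
∈-ground⇒positive x∈ with ∈-map⁻ suc x∈
... | _ , _ , refl = s≤s z≤n

1∈ground : ∀ {n} → 0 < n → 1 ∈ ground n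
1∈ground 0<n = ∈-map⁺ suc (∈-upTo⁺ 0<n)

NoInversion : List ℕ → Set
NoInversion u = ∀ {j k : Fin (length u)} → j <ᶠ k → ¬ (lookup u k < lookup u j)

noInversion⇒sorted : ∀ {u} → NoInversion u → Sorted u
noInversion⇒sorted {[]}          _  = []
noInversion⇒sorted {x ∷ []}      _  = [-]
noInversion⇒sorted {x ∷ y ∷ u} ni =
  ≮⇒≥ (ni {fzero} {fsuc fzero} (s≤s z≤n)) ∷ noInversion⇒sorted (λ j<k → ni (s≤s j<k))

noInversion⇒avoids132 : ∀ {u} → NoInversion u → Avoids132 u
noInversion⇒avoids132 ni (_ , _ , _ , _ , j<k , _ , vk<vj) = ni j<k vk<vj

avoids132⇒noInversion : ∀ {x w} → (∀ k → x < lookup w k) → Avoids132 (x ∷ w) → NoInversion (x ∷ w)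
avoids132⇒noInversion x<w _  {fzero}  {fsuc k} _   wk<x = <-asym (x<w k) wk<x
avoids132⇒noInversion x<w av {fsuc j} {fsuc k} j<k wk<wj =
  av (fzero , fsuc j , fsuc k , s≤s z≤n , j<k , x<w k , wk<wj)

sorted-↭⇒≡ : ∀ {u v} → Sorted u → Sorted v → u ↭ v → u ≡ v
sorted-↭⇒≡ u↗ v↗ u↭v = Pointwise-≡⇒≡ (↗↭↗⇒≋ ≤-totalOrder u↗ v↗ (↭⇒↭ₛ u↭v))

ground-noInversion : ∀ n → NoInversion (ground n)
ground-noInversion n {j} {k} j<k lt =
  <-asym j<k (s≤s⁻¹ (subst₂ _<_ (lookup-ground n k) (lookup-ground n j) lt))

Respects : (ℕ → ℕ → Set) → List ℕ → Set
Respects R v = (i j : Fin (length v)) → R (lookup v i) (lookup v j) → i ≤ᶠ j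

¬below-head : ∀ {R : ℕ → ℕ → Set} {a w} → Respects R (a ∷ w) → ∀ k → ¬ R (lookup w k) a
¬below-head resp k r with resp (fsuc k) fzero r
... | ()

below-head⇒≡ : ∀ {R : ℕ → ℕ → Set} {a w m} → Respects R (a ∷ w) → m ∈ a ∷ w → R m a → a ≡ m
below-head⇒≡ resp (here a≡m) _ = sym a≡m
below-head⇒≡ {R} {a} resp (there m∈w) r =
  ⊥-elim (¬below-head {R} resp (index m∈w) (subst (λ y → R y a) (lookup-index m∈w) r))

module Comb (s t : ℕ) where

  _≼_ : ℕ → ℕ → Set
  _≼_ = CombLeq s t

  generator⇒≤ : ∀ {a b} → CombGen s t a b → a ≤ b
  generator⇒≤ (spine c _)       = +-monoˡ-≤ 1 (m≤n+m (c * t) t)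
  generator⇒≤ (tooth c j _ _ _) = m≤m+n _ 1

  ≼⇒≤ : ∀ {a b} → a ≼ b → a ≤ b
  ≼⇒≤ ε       = ≤-refl
  ≼⇒≤ (g ◅ p) = ≤-trans (generator⇒≤ g) (≼⇒≤ p)

  1≼spine : ∀ c → c < s → 1 ≼ (c * t + 1)
  1≼spine zero    _   = ε
  1≼spine (suc c) c<s =
    1≼spine c (<-trans (n<1+n c) c<s) ◅◅ (spine c (subst (_≤ s) (+-comm 2 c) c<s) ◅ ε)

  spine≼tooth : ∀ c → c < s → ∀ j → j < t → (c * t + 1) ≼ (c * t + suc j)
  spine≼tooth c c<s zero    _   = ε
  spine≼tooth c c<s (suc j) j<t =
    spine≼tooth c c<s j (<-trans (n<1+n j) j<t) ◅◅ (subst (CombGen s t _) next step ◅ ε)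
    where
    step : CombGen s t (c * t + suc j) (c * t + suc j + 1)
    step = tooth c (suc j) c<s (s≤s z≤n) (subst (_≤ t) (+-comm 1 (suc j)) j<t)
    next : c * t + suc j + 1 ≡ c * t + suc (suc j)
    next = trans (+-assoc (c * t) (suc j) 1) (cong (λ z → c * t + suc z) (+-comm j 1))

  -- m + 1 sits on tooth m / t at height m % t.
  1≼ : .{{_ : NonZero t}} → ∀ {x} → x ∈ ground (s * t) → 1 ≼ x
  1≼ x∈ with ∈-map⁻ suc x∈
  ... | m , m∈ , refl =
    subst (1 ≼_) position (1≼spine (m / t) q<s ◅◅ spine≼tooth (m / t) q<s (m % t) (m%n<n m t))
    where
    divmod : m ≡ m % t + m / t * t
    divmod = m≡m%n+[m/n]*n m t
    q<s : m / t < s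
    q<s = ≰⇒> (λ s≤q → <⇒≱ (∈-upTo⁻ m∈)
            (≤-trans (*-monoˡ-≤ t s≤q) (≤-trans (m≤n+m (m / t * t) (m % t)) (≤-reflexive (sym divmod)))))
    position : m / t * t + suc (m % t) ≡ suc m
    position = trans (+-comm (m / t * t) (suc (m % t))) (cong suc (sym divmod))

  ground-isLinearExtension : IsLinearExtension s t (ground (s * t))
  ground-isLinearExtension = ↭-refl , λ i j vi≼vj →
    s≤s⁻¹ (subst₂ _≤_ (lookup-ground (s * t) i) (lookup-ground (s * t) j) (≼⇒≤ vi≼vj))

  linearExtension-head≡1 : .{{_ : NonZero t}} → ∀ {a w} → 1 ∈ a ∷ w →
    IsLinearExtension s t (a ∷ w) → a ≡ 1
  linearExtension-head≡1 1∈ (aw↭ , resp) = below-head⇒≡ {_≼_} resp 1∈ (1≼ (∈-resp-↭ aw↭ (here refl)))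

  1∈ground[st] : .{{_ : NonZero s}} .{{_ : NonZero t}} → 1 ∈ ground (s * t)
  1∈ground[st] = 1∈ground (>-nonZero⁻¹ (s * t) {{m*n≢0 s t}})

  linearExtension-avoids132⇒≡ground : .{{_ : NonZero s}} .{{_ : NonZero t}} →
    ∀ w → IsLinearExtension s t w → Avoids132 w → w ≡ ground (s * t)
  linearExtension-avoids132⇒≡ground [] (↭st , _) _ with ∈-resp-↭ (↭-sym ↭st) 1∈ground[st]
  ... | ()
  linearExtension-avoids132⇒≡ground (a ∷ w) le@(↭st , resp) av
    with linearExtension-head≡1 (∈-resp-↭ (↭-sym ↭st) 1∈ground[st]) le
  ... | refl = sorted-↭⇒≡ (noInversion⇒sorted (avoids132⇒noInversion 1<w av))
                          (noInversion⇒sorted (ground-noInversion (s * t))) ↭st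
    where
    -- An entry equal to 1 after the head would be ≼-below the head.
    1<w : ∀ k → 1 < lookup w k
    1<w k = ≤∧≢⇒< (∈-ground⇒positive (∈-resp-↭ ↭st (there (∈-lookup k))))
                  (λ 1≡wk → ¬below-head {_≼_} resp k (subst (_≼ 1) 1≡wk ε))

theorem8 : (s t : ℕ) → 1 ≤ s → 1 ≤ t →
    ∃[ v ] ((IsLinearExtension s t v × Avoids132 v) ×
            ((w : List ℕ) → IsLinearExtension s t w → Avoids132 w → w ≡ v))
theorem8 s@(suc _) t@(suc _) _ _ =
  ground (s * t) ,
  (ground-isLinearExtension , noInversion⇒avoids132 (ground-noInversion (s * t))) ,
  linearExtension-avoids132⇒≡ground
  where open Comb s t
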